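{- Let $M$ be an $n$-semi-MPG or an $(n_1,n_2,\ldots,n_k)$-semi-MPG with $n,n_i\ge 3$, where two outer facets are allowed to share edges, and let $T_{rgb}$ be an RGB-tiling of $M$. Counting each edge shared by two outer facets with multiplicity 2, the numbers of red, green and blue edges along $\Omega(M)$ are all even if $|\Omega(M)|$ is even, and all odd if $|\Omega(M)|$ is odd.
   Context: A semi-MPG is a connected simple plane graph in which every face is a triangle except some designated faces called outer facets, which form the border of the graph; an outer facet that is an $m$-sided polygon is an $m$-gon. An $(n_1,\ldots,n_k)$-semi-MPG has exactly $k$ outer facets of sizes $n_1,\ldots,n_k$; an $n$-semi-MPG has a single outer facet of size $n$. 3-gon outer facets are allowed. $\Omega(M)$ is the collection of edges along the outer facets, with an edge shared by two outer facets counted twice, so $|\Omega(M)|=\sum_i n_i$. An RGB-tiling is a map $T_{rgb}:E(M)\to\{\text{red},\text{green},\text{blue}\}$ such that every triangular face that is not an outer facet has its three edges colored with three different colors (edges shared by two outer facets lie in no such face and may have any color). -}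

module Defs where

open import Data.Nat using (ℕ; zero; suc; _+_; _≤_)
open import Data.Nat.Divisibility using (_∣_)
open import Data.Fin using (Fin; zero; suc) renaming (_≟_ to _≟ᶠ_)
open import Data.Bool using (Bool; true; false; not; _∧_)
open import Data.Product using (_×_; _,_; proj₁; proj₂; ∃)
open import Relation.Nullary using (¬_)
open import Relation.Nullary.Decidable using (⌊_⌋)
open import Relation.Binary.PropositionalEquality using (_≡_; _≢_)

-- Combinatorial-map encoding of a plane graph.
-- Darts (half-edges) of a graph with E edges: edge i has two darts (i , false), (i , true).
Dart : ℕ → Set
Dart E = Fin E × Bool

flip : ∀ {E} → Dart E → Dart E
flip (i , b) = (i , not b)

iter : ∀ {A : Set} → (A → A) → ℕ → A → A
iter f zero    x = x
iter f (suc k) x = f (iter f k x)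

countFin : (n : ℕ) → (Fin n → Bool) → ℕ
countFin zero    p = 0
countFin (suc n) p = (if p zero then 1 else 0) + countFin n (λ i → p (suc i))
  where open import Data.Bool using (if_then_else_)

countDarts : (E : ℕ) → (Dart E → Bool) → ℕ
countDarts E p = countFin E (λ i → p (i , false)) + countFin E (λ i → p (i , true))

data Reach {V E : ℕ} (tail : Dart E → Fin V) : Fin V → Fin V → Set where
  here : ∀ {u} → Reach tail u u
  step : ∀ {v} (d : Dart E) → Reach tail (tail (flip d)) v → Reach tail (tail d) v

-- A semi-MPG, given as a connected simple graph embedded on the sphere
-- (rotation system σ, edge involution flip, faces = orbits of φ = σ ∘ flip,
--  genus 0 via Euler's formula), with designated outer facets.
record SemiMPG : Set where
  field
    V E F : ℕ
    σ σ⁻¹ : Dart E → Dart E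
    σσ⁻¹ : ∀ d → σ (σ⁻¹ d) ≡ d
    σ⁻¹σ : ∀ d → σ⁻¹ (σ d) ≡ d
    tail : Dart E → Fin V
    tail-σ : ∀ d → tail (σ d) ≡ tail d
    tail-orbit : ∀ d e → tail d ≡ tail e → ∃ λ k → iter σ k d ≡ e
    tail-onto : ∀ v → ∃ λ d → tail d ≡ v
    noLoop : ∀ d → tail d ≢ tail (flip d)
    noMulti : ∀ d e → tail d ≡ tail e → tail (flip d) ≡ tail (flip e) → d ≡ e
    connected : ∀ u v → Reach tail u v
    face : Dart E → Fin F
    face-φ : ∀ d → face (σ (flip d)) ≡ face d
    face-orbit : ∀ d e → face d ≡ face e → ∃ λ k → iter (λ x → σ (flip x)) k d ≡ e
    face-onto : ∀ f → ∃ λ d → face d ≡ f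
    euler : V + F ≡ E + 2
    outer : Fin F → Bool
    someOuter : ∃ λ f → outer f ≡ true
    inner-triangle : ∀ f → outer f ≡ false → countDarts E (λ d → ⌊ face d ≟ᶠ f ⌋) ≡ 3
    outer-size : ∀ f → outer f ≡ true → 3 ≤ countDarts E (λ d → ⌊ face d ≟ᶠ f ⌋)
    outer-polygon : ∀ d e → outer (face d) ≡ true → face d ≡ face e → tail d ≡ tail e → d ≡ e

open SemiMPG public

data Color : Set where
  red green blue : Color

_≟ᶜ_ : Color → Color → Bool
red   ≟ᶜ red   = true
green ≟ᶜ green = true
blue  ≟ᶜ blue  = true
_     ≟ᶜ _     = false

φ : (M : SemiMPG) → Dart (E M) → Dart (E M)
φ M d = σ M (flip d)

IsRGBTiling : (M : SemiMPG) → (Fin (E M) → Color) → Set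
IsRGBTiling M col = ∀ d → outer M (face M d) ≡ false →
  (col (proj₁ d) ≢ col (proj₁ (φ M d))) ×
  (col (proj₁ (φ M d)) ≢ col (proj₁ (φ M (φ M d)))) ×
  (col (proj₁ d) ≢ col (proj₁ (φ M (φ M d))))

-- |Ω(M)|: darts lying in outer facets (an edge shared by two outer facets counts twice)
Ωsize : SemiMPG → ℕ
Ωsize M = countDarts (E M) (λ d → outer M (face M d))

Ωcolor : (M : SemiMPG) → (Fin (E M) → Color) → Color → ℕ
Ωcolor M col c = countDarts (E M) (λ d → outer M (face M d) ∧ (col (proj₁ d) ≟ᶜ c))

-- Fix a colour c. The darts not coloured c come in pairs {d, flip d}, so there are
-- evenly many. In an inner face the darts φ⁻¹ d, d, φ d carry three different colours,
-- so an inner dart d not coloured c has exactly one neighbour, φ d or φ⁻¹ d, not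
-- coloured c either; this pairs up the inner darts not coloured c (the face sizes
-- never enter). Hence the boundary darts not coloured c are even in number, and |Ω(M)|
-- has the same parity as the number of boundary darts coloured c.
module Submission where

open import Defs
open import Algebra.Properties.CommutativeSemigroup using (interchange)
open import Data.Bool using (Bool; true; false; not; _∧_; if_then_else_)
open import Data.Bool.Properties using (∧-comm; ∧-identityʳ; ∧-zeroʳ; not-involutive)
  renaming (_≟_ to _≟ᵇ_)
open import Data.Fin using (Fin; zero; suc)
import Data.Fin.Properties as Finₚ
open import Data.Nat using (ℕ; zero; suc; _+_)
open import Data.Nat.Divisibility using (_∣_; _∣0; ∣-refl; ∣m∣n⇒∣m+n; ∣m+n∣m⇒∣n)
open import Data.Nat.Properties using (+-suc; +-comm; suc-injective; +-commutativeSemigroup)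
open import Data.Product using (_×_; _,_; proj₁; proj₂; ∃)
open import Data.Product.Properties using (≡-dec)
open import Function using (_∘_; _⇔_; mk⇔; Equivalence)
open import Relation.Binary.Definitions using (DecidableEquality)
open import Relation.Nullary using (¬_; yes; no; contradiction)
open import Relation.Nullary.Decidable using (does; dec-true; dec-false)
open import Relation.Binary.PropositionalEquality

not-∧-not : ∀ {x y} → not x ∧ not y ≡ true → x ≡ false × y ≡ false
not-∧-not {false} {false} _ = refl , refl

∣n⇒[∣m+n⇔∣m] : ∀ {d m n} → d ∣ n → (d ∣ m + n ⇔ d ∣ m)
∣n⇒[∣m+n⇔∣m] {d} {m} {n} d∣n =
  mk⇔ (λ d∣m+n → ∣m+n∣m⇒∣n (subst (d ∣_) (+-comm m n) d∣m+n) d∣n)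
      (λ d∣m → ∣m∣n⇒∣m+n d∣m d∣n)

countFin-cong : ∀ {n} {p q : Fin n → Bool} → (∀ i → p i ≡ q i) →
                countFin n p ≡ countFin n q
countFin-cong {zero}  p≗q = refl
countFin-cong {suc n} p≗q = cong₂ (λ b k → (if b then 1 else 0) + k)
                                  (p≗q zero) (countFin-cong (p≗q ∘ suc))

countFin-split : ∀ {n} (p q : Fin n → Bool) →
                 countFin n p ≡ countFin n (λ i → p i ∧ q i) + countFin n (λ i → p i ∧ not (q i))
countFin-split {zero}  p q = refl
countFin-split {suc n} p q with p zero | q zero
... | true  | true  = cong suc (countFin-split (p ∘ suc) (q ∘ suc))
... | true  | false = trans (cong suc (countFin-split (p ∘ suc) (q ∘ suc))) (sym (+-suc _ _))
... | false | _     = countFin-split (p ∘ suc) (q ∘ suc)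

countFin-remove : ∀ {n} {p q : Fin n → Bool} a → p a ≡ true → q a ≡ false →
                  (∀ i → i ≢ a → p i ≡ q i) → countFin n p ≡ suc (countFin n q)
countFin-remove {suc n} {p} {q} zero pa qa agree rewrite pa | qa =
  cong suc (countFin-cong λ i → agree (suc i) λ ())
countFin-remove {suc n} {p} {q} (suc a) pa qa agree rewrite agree zero (λ ()) =
  trans (cong (b +_) (countFin-remove a pa qa λ i i≢a → agree (suc i) (i≢a ∘ Finₚ.suc-injective)))
        (+-suc b _)
  where b = if q zero then 1 else 0

countFin-witness : ∀ {n k} (p : Fin n → Bool) → countFin n p ≡ suc k → ∃ λ i → p i ≡ true
countFin-witness {suc n} p count≡ with p zero in p0
... | true  = zero , p0
... | false with countFin-witness (p ∘ suc) count≡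
...   | i , pi = suc i , pi

countDarts-cong : ∀ {E} {p q : Dart E → Bool} → (∀ d → p d ≡ q d) →
                  countDarts E p ≡ countDarts E q
countDarts-cong p≗q = cong₂ _+_ (countFin-cong (λ i → p≗q (i , false)))
                                (countFin-cong (λ i → p≗q (i , true)))

countDarts-split : ∀ {E} (p q : Dart E → Bool) →
                   countDarts E p ≡ countDarts E (λ d → p d ∧ q d) + countDarts E (λ d → p d ∧ not (q d))
countDarts-split {E} p q =
  trans (cong₂ _+_ (countFin-split _ (λ i → q (i , false))) (countFin-split _ (λ i → q (i , true))))
        (interchange +-commutativeSemigroup (count false q) (count false (not ∘ q))
                                            (count true q) (count true (not ∘ q)))
  where
  count : Bool → (Dart E → Bool) → ℕ
  count b r = countFin E (λ i → p (i , b) ∧ r (i , b))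

countDarts-remove : ∀ {E} {p q : Dart E → Bool} a → p a ≡ true → q a ≡ false →
                    (∀ d → d ≢ a → p d ≡ q d) → countDarts E p ≡ suc (countDarts E q)
countDarts-remove (i , false) pa qa agree =
  cong₂ _+_ (countFin-remove i pa qa λ j j≢i → agree (j , false) (j≢i ∘ cong proj₁))
            (countFin-cong λ j → agree (j , true) λ ())
countDarts-remove (i , true) pa qa agree =
  trans (cong₂ _+_ (countFin-cong λ j → agree (j , false) λ ())
                   (countFin-remove i pa qa λ j j≢i → agree (j , true) (j≢i ∘ cong proj₁)))
        (+-suc _ _)

countDarts-witness : ∀ {E k} (p : Dart E → Bool) → countDarts E p ≡ suc k → ∃ λ d → p d ≡ true
countDarts-witness {E} p count≡ with countFin E (λ i → p (i , false)) in c₀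
... | zero  = let i , pi = countFin-witness _ count≡ in (i , true) , pi
... | suc _ = let i , pi = countFin-witness _ c₀ in (i , false) , pi

_≟ᵈ_ : ∀ {E} → DecidableEquality (Dart E)
_≟ᵈ_ = ≡-dec Finₚ._≟_ _≟ᵇ_

_∖_ : ∀ {E} → (Dart E → Bool) → Dart E → Dart E → Bool
(p ∖ a) d = p d ∧ not (does (d ≟ᵈ a))

∖-removes : ∀ {E} (p : Dart E → Bool) a → (p ∖ a) a ≡ false
∖-removes p a rewrite dec-true (a ≟ᵈ a) refl = ∧-zeroʳ (p a)

∖-keeps : ∀ {E} (p : Dart E → Bool) {a d} → d ≢ a → p d ≡ (p ∖ a) d
∖-keeps p {a} {d} d≢a rewrite dec-false (d ≟ᵈ a) d≢a = sym (∧-identityʳ (p d))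

∖-true : ∀ {E} (p : Dart E → Bool) {a d} → (p ∖ a) d ≡ true → p d ≡ true × d ≢ a
∖-true p {a} {d} h with d ≟ᵈ a
... | yes refl = contradiction (trans (sym (∧-zeroʳ (p d))) h) λ ()
... | no d≢a   = trans (sym (∧-identityʳ (p d))) h , d≢a

countDarts-∖ : ∀ {E} (p : Dart E → Bool) {a} → p a ≡ true → countDarts E p ≡ suc (countDarts E (p ∖ a))
countDarts-∖ p {a} pa = countDarts-remove a pa (∖-removes p a) λ d → ∖-keeps p

record FreeInvolutionOn {E} (p : Dart E → Bool) (τ : Dart E → Dart E) : Set where
  field
    preserves     : ∀ {d} → p d ≡ true → p (τ d) ≡ true
    involutive    : ∀ {d} → p d ≡ true → τ (τ d) ≡ d
    fixpoint-free : ∀ {d} → p d ≡ true → τ d ≢ d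

module _ {E} {τ : Dart E → Dart E} where

  FreeInvolutionOn-∖-pair : ∀ {p a} → FreeInvolutionOn p τ → p a ≡ true →
                            FreeInvolutionOn ((p ∖ a) ∖ τ a) τ
  FreeInvolutionOn-∖-pair {p} {a} inv pa = record
    { preserves     = λ {d} h → let pd , d≢a , d≢τa = unpack h in
        ∖-repack (preserves pd)
          (λ τd≡a → d≢τa (trans (sym (involutive pd)) (cong τ τd≡a)))
          (λ τd≡τa → d≢a (trans (sym (involutive pd)) (trans (cong τ τd≡τa) (involutive pa))))
    ; involutive    = λ h → involutive (proj₁ (unpack h))
    ; fixpoint-free = λ h → fixpoint-free (proj₁ (unpack h))
    }
    where
    open FreeInvolutionOn inv
    unpack : ∀ {d} → ((p ∖ a) ∖ τ a) d ≡ true → p d ≡ true × d ≢ a × d ≢ τ a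
    unpack h = let h′ , d≢τa = ∖-true (p ∖ a) h ; pd , d≢a = ∖-true p h′ in pd , d≢a , d≢τa
    ∖-repack : ∀ {d} → p d ≡ true → d ≢ a → d ≢ τ a → ((p ∖ a) ∖ τ a) d ≡ true
    ∖-repack {d} pd d≢a d≢τa =
      trans (sym (∖-keeps (p ∖ a) d≢τa)) (trans (sym (∖-keeps p d≢a)) pd)

  countDarts-∖-pair : ∀ {p a} → FreeInvolutionOn p τ → p a ≡ true →
                      countDarts E p ≡ suc (suc (countDarts E ((p ∖ a) ∖ τ a)))
  countDarts-∖-pair {p} {a} inv pa =
    trans (countDarts-∖ p pa)
          (cong suc (countDarts-∖ (p ∖ a) (trans (sym (∖-keeps p (fixpoint-free pa))) (preserves pa))))
    where open FreeInvolutionOn inv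

  countDarts≡k⇒2∣k : ∀ k {p} → FreeInvolutionOn p τ → countDarts E p ≡ k → 2 ∣ k
  countDarts≡k⇒2∣k zero    inv count≡ = 2 ∣0
  countDarts≡k⇒2∣k (suc k) {p} inv count≡ with countDarts-witness p count≡
  ... | a , pa with k | trans (sym (countDarts-∖-pair inv pa)) count≡
  ...   | zero  | ()
  ...   | suc j | count≡′ = ∣m∣n⇒∣m+n ∣-refl
    (countDarts≡k⇒2∣k j (FreeInvolutionOn-∖-pair inv pa) (suc-injective (suc-injective count≡′)))

  countDarts-even : ∀ p → FreeInvolutionOn p τ → 2 ∣ countDarts E p
  countDarts-even p inv = countDarts≡k⇒2∣k _ inv refl

≟ᶜ-true⇒≡ : ∀ {x y} → (x ≟ᶜ y) ≡ true → x ≡ y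
≟ᶜ-true⇒≡ {red}   {red}   _ = refl
≟ᶜ-true⇒≡ {green} {green} _ = refl
≟ᶜ-true⇒≡ {blue}  {blue}  _ = refl
≟ᶜ-true⇒≡ {red}   {green} ()
≟ᶜ-true⇒≡ {red}   {blue}  ()
≟ᶜ-true⇒≡ {green} {red}   ()
≟ᶜ-true⇒≡ {green} {blue}  ()
≟ᶜ-true⇒≡ {blue}  {red}   ()
≟ᶜ-true⇒≡ {blue}  {green} ()

≡⇒≟ᶜ-true : ∀ {x y} → x ≡ y → (x ≟ᶜ y) ≡ true
≡⇒≟ᶜ-true {red}   refl = refl
≡⇒≟ᶜ-true {green} refl = refl
≡⇒≟ᶜ-true {blue}  refl = refl

≟ᶜ-false⇒≢ : ∀ {x y} → (x ≟ᶜ y) ≡ false → x ≢ y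
≟ᶜ-false⇒≢ x≟y x≡y = contradiction (trans (sym x≟y) (≡⇒≟ᶜ-true x≡y)) λ ()

≢⇒≟ᶜ-false : ∀ {x y} → x ≢ y → (x ≟ᶜ y) ≡ false
≢⇒≟ᶜ-false {x} {y} x≢y with x ≟ᶜ y in x≟y
... | true  = contradiction (≟ᶜ-true⇒≡ x≟y) x≢y
... | false = refl

missing-colour : ∀ {x y z c : Color} → x ≢ y → x ≢ z → y ≢ z → x ≢ c → y ≢ c → z ≡ c
missing-colour {red}   {red}                   x≢y _   _   _   _   = contradiction refl x≢y
missing-colour {green} {green}                 x≢y _   _   _   _   = contradiction refl x≢y
missing-colour {blue}  {blue}                  x≢y _   _   _   _   = contradiction refl x≢y
missing-colour {red}   {green} {red}           _   x≢z _   _   _   = contradiction refl x≢z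
missing-colour {red}   {green} {green}         _   _   y≢z _   _   = contradiction refl y≢z
missing-colour {red}   {green} {blue}  {red}   _   _   _   x≢c _   = contradiction refl x≢c
missing-colour {red}   {green} {blue}  {green} _   _   _   _   y≢c = contradiction refl y≢c
missing-colour {red}   {green} {blue}  {blue}  _   _   _   _   _   = refl
missing-colour {red}   {blue}  {red}           _   x≢z _   _   _   = contradiction refl x≢z
missing-colour {red}   {blue}  {blue}          _   _   y≢z _   _   = contradiction refl y≢z
missing-colour {red}   {blue}  {green} {red}   _   _   _   x≢c _   = contradiction refl x≢c
missing-colour {red}   {blue}  {green} {blue}  _   _   _   _   y≢c = contradiction refl y≢c
missing-colour {red}   {blue}  {green} {green} _   _   _   _   _   = refl
missing-colour {green} {red}   {green}         _   x≢z _   _   _   = contradiction refl x≢z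
missing-colour {green} {red}   {red}           _   _   y≢z _   _   = contradiction refl y≢z
missing-colour {green} {red}   {blue}  {green} _   _   _   x≢c _   = contradiction refl x≢c
missing-colour {green} {red}   {blue}  {red}   _   _   _   _   y≢c = contradiction refl y≢c
missing-colour {green} {red}   {blue}  {blue}  _   _   _   _   _   = refl
missing-colour {green} {blue}  {green}         _   x≢z _   _   _   = contradiction refl x≢z
missing-colour {green} {blue}  {blue}          _   _   y≢z _   _   = contradiction refl y≢z
missing-colour {green} {blue}  {red}   {green} _   _   _   x≢c _   = contradiction refl x≢c
missing-colour {green} {blue}  {red}   {blue}  _   _   _   _   y≢c = contradiction refl y≢c
missing-colour {green} {blue}  {red}   {red}   _   _   _   _   _   = refl
missing-colour {blue}  {red}   {blue}          _   x≢z _   _   _   = contradiction refl x≢z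
missing-colour {blue}  {red}   {red}           _   _   y≢z _   _   = contradiction refl y≢z
missing-colour {blue}  {red}   {green} {blue}  _   _   _   x≢c _   = contradiction refl x≢c
missing-colour {blue}  {red}   {green} {red}   _   _   _   _   y≢c = contradiction refl y≢c
missing-colour {blue}  {red}   {green} {green} _   _   _   _   _   = refl
missing-colour {blue}  {green} {blue}          _   x≢z _   _   _   = contradiction refl x≢z
missing-colour {blue}  {green} {green}         _   _   y≢z _   _   = contradiction refl y≢z
missing-colour {blue}  {green} {red}   {blue}  _   _   _   x≢c _   = contradiction refl x≢c
missing-colour {blue}  {green} {red}   {green} _   _   _   _   y≢c = contradiction refl y≢c
missing-colour {blue}  {green} {red}   {red}   _   _   _   _   _   = refl

flip-involutive : ∀ {E} (d : Dart E) → flip (flip d) ≡ d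
flip-involutive (i , b) = cong (i ,_) (not-involutive b)

flip-fixpoint-free : ∀ {E} (d : Dart E) → flip d ≢ d
flip-fixpoint-free (i , false) ()
flip-fixpoint-free (i , true)  ()

module _ (M : SemiMPG) where

  φ⁻¹ : Dart (E M) → Dart (E M)
  φ⁻¹ d = flip (σ⁻¹ M d)

  φ-φ⁻¹ : ∀ d → φ M (φ⁻¹ d) ≡ d
  φ-φ⁻¹ d = trans (cong (σ M) (flip-involutive (σ⁻¹ M d))) (σσ⁻¹ M d)

  φ⁻¹-φ : ∀ d → φ⁻¹ (φ M d) ≡ d
  φ⁻¹-φ d = trans (cong flip (σ⁻¹σ M (flip d))) (flip-involutive d)

  face-φ⁻¹ : ∀ d → face M (φ⁻¹ d) ≡ face M d
  face-φ⁻¹ d = trans (sym (face-φ M (φ⁻¹ d))) (cong (face M) (φ-φ⁻¹ d))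

module ColourParity (M : SemiMPG) (col : Fin (E M) → Color) (rgb : IsRGBTiling M col)
                    (c : Color) where

  colour : Dart (E M) → Color
  colour = col ∘ proj₁

  coloured : Dart (E M) → Bool
  coloured d = colour d ≟ᶜ c

  onBorder : Dart (E M) → Bool
  onBorder d = outer M (face M d)

  innerUncoloured outerUncoloured : Dart (E M) → Bool
  innerUncoloured d = not (coloured d) ∧ not (onBorder d)
  outerUncoloured d = not (coloured d) ∧ onBorder d

  colour-≢ : ∀ {x y} → colour x ≢ colour y → x ≢ y
  colour-≢ cx≢cy refl = cx≢cy refl

  inner-φ : ∀ {d} → onBorder d ≡ false → onBorder (φ M d) ≡ false
  inner-φ {d} inner = trans (cong (outer M) (face-φ M d)) inner

  inner-φ⁻¹ : ∀ {d} → onBorder d ≡ false → onBorder (φ⁻¹ M d) ≡ false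
  inner-φ⁻¹ {d} inner = trans (cong (outer M) (face-φ⁻¹ M d)) inner

  partner : Dart (E M) → Dart (E M)
  partner d = if coloured (φ M d) then φ⁻¹ M d else φ M d

  partner-coloured : ∀ {d} → coloured (φ M d) ≡ true → partner d ≡ φ⁻¹ M d
  partner-coloured {d} h = cong (λ b → if b then φ⁻¹ M d else φ M d) h

  partner-uncoloured : ∀ {d} → coloured (φ M d) ≡ false → partner d ≡ φ M d
  partner-uncoloured {d} h = cong (λ b → if b then φ⁻¹ M d else φ M d) h

  Partners : Dart (E M) → Dart (E M) → Set
  Partners d d′ = innerUncoloured d′ ≡ true × partner d′ ≡ d × d′ ≢ d

  partner-φ⁻¹ : ∀ {d} → innerUncoloured d ≡ true → coloured (φ M d) ≡ true → Partners d (φ⁻¹ M d)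
  partner-φ⁻¹ {d} h φd-coloured =
      cong₂ (λ a b → not a ∧ not b) d⁻-uncoloured d⁻-inner
    , trans (partner-uncoloured (trans (cong coloured (φ-φ⁻¹ M d)) d-uncoloured)) (φ-φ⁻¹ M d)
    , colour-≢ d⁻≢d
    where
    d⁻ = φ⁻¹ M d
    d-uncoloured = proj₁ (not-∧-not h)
    d⁻-inner = inner-φ⁻¹ (proj₂ (not-∧-not h))
    triangle = rgb d⁻ d⁻-inner
    d⁻≢d : colour d⁻ ≢ colour d
    d⁻≢d = subst (λ x → colour d⁻ ≢ colour x) (φ-φ⁻¹ M d) (proj₁ triangle)
    d⁻≢φd : colour d⁻ ≢ colour (φ M d)
    d⁻≢φd = subst (λ x → colour d⁻ ≢ colour (φ M x)) (φ-φ⁻¹ M d) (proj₂ (proj₂ triangle))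
    d⁻-uncoloured : coloured d⁻ ≡ false
    d⁻-uncoloured = ≢⇒≟ᶜ-false λ d⁻≡c → d⁻≢φd (trans d⁻≡c (sym (≟ᶜ-true⇒≡ φd-coloured)))

  partner-φ : ∀ {d} → innerUncoloured d ≡ true → coloured (φ M d) ≡ false → Partners d (φ M d)
  partner-φ {d} h φd-uncoloured =
      cong₂ (λ a b → not a ∧ not b) φd-uncoloured (inner-φ d-inner)
    , trans (partner-coloured φφd-coloured) (φ⁻¹-φ M d)
    , colour-≢ (d≢φd ∘ sym)
    where
    d-uncoloured = proj₁ (not-∧-not h)
    d-inner = proj₂ (not-∧-not h)
    triangle = rgb d d-inner
    d≢φd = proj₁ triangle
    φφd-coloured : coloured (φ M (φ M d)) ≡ true
    φφd-coloured = ≡⇒≟ᶜ-true (missing-colour d≢φd (proj₂ (proj₂ triangle)) (proj₁ (proj₂ triangle))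
                                (≟ᶜ-false⇒≢ d-uncoloured) (≟ᶜ-false⇒≢ φd-uncoloured))

  partners : ∀ {d} → innerUncoloured d ≡ true → Partners d (partner d)
  partners {d} h = by-colour-of-φd (coloured (φ M d)) refl
    where
    by-colour-of-φd : ∀ b → coloured (φ M d) ≡ b → Partners d (partner d)
    by-colour-of-φd true  e = subst (Partners d) (sym (partner-coloured e)) (partner-φ⁻¹ h e)
    by-colour-of-φd false e = subst (Partners d) (sym (partner-uncoloured e)) (partner-φ h e)

  innerUncoloured-even : 2 ∣ countDarts (E M) innerUncoloured
  innerUncoloured-even = countDarts-even innerUncoloured record
    { preserves     = proj₁ ∘ partners
    ; involutive    = proj₁ ∘ proj₂ ∘ partners
    ; fixpoint-free = proj₂ ∘ proj₂ ∘ partners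
    }

  uncoloured-even : 2 ∣ countDarts (E M) (not ∘ coloured)
  uncoloured-even = countDarts-even {τ = flip} (not ∘ coloured) record
    { preserves     = λ h → h
    ; involutive    = λ {d} _ → flip-involutive d
    ; fixpoint-free = λ {d} _ → flip-fixpoint-free d
    }

  outerUncoloured-even : 2 ∣ countDarts (E M) outerUncoloured
  outerUncoloured-even = Equivalence.to (∣n⇒[∣m+n⇔∣m] innerUncoloured-even)
    (subst (2 ∣_) (countDarts-split (not ∘ coloured) onBorder) uncoloured-even)

  Ωsize-split : Ωsize M ≡ Ωcolor M col c + countDarts (E M) outerUncoloured
  Ωsize-split = trans (countDarts-split onBorder coloured)
    (cong (Ωcolor M col c +_) (countDarts-cong λ d → ∧-comm (onBorder d) (not (coloured d))))

  Ωsize-even⇔Ωcolor-even : 2 ∣ Ωsize M ⇔ 2 ∣ Ωcolor M col c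
  Ωsize-even⇔Ωcolor-even = subst (λ n → 2 ∣ n ⇔ 2 ∣ Ωcolor M col c)
    (sym Ωsize-split) (∣n⇒[∣m+n⇔∣m] outerUncoloured-even)

corollary6p4 : (M : SemiMPG) (col : Fin (E M) → Color) → IsRGBTiling M col →
    (2 ∣ Ωsize M → ∀ c → 2 ∣ Ωcolor M col c) ×
    (¬ (2 ∣ Ωsize M) → ∀ c → ¬ (2 ∣ Ωcolor M col c))
corollary6p4 M col rgb =
    (λ Ω-even c → Equivalence.to (Ωsize-even⇔Ωcolor-even c) Ω-even)
  , (λ Ω-odd c → Ω-odd ∘ Equivalence.from (Ωsize-even⇔Ωcolor-even c))
  where open ColourParity M col rgb
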